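{- For every fixed positive integer $k$ there are at most finitely many finite sets $Q$ of primes with $2,3\notin Q$ and $|Q|=k$ satisfying $$3\cdot \prod_{q\in Q}(q-1) - 2\prod_{q\in Q} q = 2;$$ equivalently, at most finitely many such solutions $n=\prod_{q\in Q}q$ having exactly $k$ prime divisors. -}

module Defs where

open import Data.Nat using (ℕ; _*_; _+_; _∸_)
open import Data.List using (List; map; length)
open import Data.Nat.ListAction using (product)
open import Data.List.Relation.Unary.All using (All)
open import Data.List.Relation.Unary.Unique.Propositional using (Unique)
open import Data.List.Membership.Propositional using (_∉_)
open import Data.Nat.Primality using (Prime)
open import Data.Product using (_×_)
open import Relation.Binary.PropositionalEquality using (_≡_)

-- A finite set Q of primes is represented by a duplicate-free list of primes;
-- two lists represent the same set iff they are permutations of each other.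
-- ValidSet k Q : Q is a set of k primes, 2,3 ∉ Q, and
--   3 · ∏(q-1) - 2 · ∏ q = 2   (written without truncated subtraction).
ValidSet : ℕ → List ℕ → Set
ValidSet k Q =
  Unique Q × All Prime Q × 2 ∉ Q × 3 ∉ Q × length Q ≡ k ×
  (3 * product (map (λ q → q ∸ 1) Q) ≡ 2 * product Q + 2)

-- Write the condition as A ∏ (x - 1) = B ∏ x + C with C ≥ 1 (here A = 3, B = C = 2) and let q be
-- the least of the m factors. Then A > B, and Weierstrass' inequality ∏ (1 - 1/x) ≥ 1 - m/q gives
-- (B + 1) q ∏ x ≤ A q ∏ (x - 1) + A m ∏ x = q (B ∏ x + C) + A m ∏ x, whence q ≤ A m + C.
-- Splitting q off leaves an equation of the same shape with coefficients A (q - 1), B q, C and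
-- m - 1 factors, so induction bounds every factor by a function of m, A and C alone; there are
-- finitely many lists of k numbers below that bound.
module Submission where

open import Defs
open import Data.Nat using (ℕ; zero; suc; _+_; _*_; _∸_; _≤_; _<_; _≥_; _⊔_; z≤n; s≤s; NonZero)
open import Data.Nat.Properties
open import Data.Nat.ListAction using (product)
open import Data.Nat.ListAction.Properties using (product-↭; product≢0)
open import Data.Nat.Primality using (prime⇒nonZero)
open import Data.Nat.Tactic.RingSolver using (solve)
open import Data.List using (List; []; _∷_; [_]; map; length; upTo; cartesianProductWith)
open import Data.List.Membership.Propositional using (_∈_)
open import Data.List.Membership.Propositional.Properties using (∈-upTo⁺; ∈-cartesianProductWith⁺)
open import Data.List.Relation.Unary.Any using (Any; here)
import Data.List.Relation.Unary.Any as Any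
open import Data.List.Relation.Unary.Linked.Properties using (Linked⇒AllPairs)
open import Data.List.Relation.Binary.Permutation.Propositional using (_↭_; ↭-sym; ↭-reflexive)
open import Data.List.Relation.Binary.Permutation.Propositional.Properties using (All-resp-↭; map⁺; ↭-length)
open import Data.List.Sort ≤-decTotalOrder using (sort; sort-↭; sort-↗)
open import Data.Product using (∃; _,_)
open import Relation.Binary.PropositionalEquality using (_≡_; refl; sym; trans; cong)

weierstrass-step : ∀ {q x p f m} → q ≤ x → q * p ≤ q * f + m * p →
                   q * (x * p) ≤ q * ((x ∸ 1) * f) + suc m * (x * p)
weierstrass-step {q} {zero}          _   _  = ≤-trans (≤-reflexive (*-zeroʳ q)) z≤n
weierstrass-step {q} {suc y} {p} {f} {m} q≤x ih = begin
  q * (suc y * p)                       ≡⟨ solve (q ∷ y ∷ p ∷ []) ⟩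
  y * (q * p) + q * p                   ≤⟨ +-mono-≤ (*-monoʳ-≤ y ih) (*-monoˡ-≤ p q≤x) ⟩
  y * (q * f + m * p) + suc y * p       ≡⟨ solve (q ∷ y ∷ p ∷ f ∷ m ∷ []) ⟩
  q * (y * f) + (y * m * p + suc y * p) ≤⟨ +-monoʳ-≤ (q * (y * f)) (+-monoˡ-≤ (suc y * p) y*m*p≤x*m*p) ⟩
  q * (y * f) + (suc y * m * p + suc y * p) ≡⟨ solve (q ∷ y ∷ p ∷ f ∷ m ∷ []) ⟩
  q * (y * f) + suc m * (suc y * p)     ∎
  where
    open ≤-Reasoning
    y*m*p≤x*m*p : y * m * p ≤ suc y * m * p
    y*m*p≤x*m*p = *-monoˡ-≤ p (*-monoˡ-≤ m (n≤1+n y))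

least-factor-bound-arith : ∀ {A B C q m n f} .{{_ : NonZero n}} → B < A → q ≤ n →
                           q * n ≤ q * f + m * n → A * f ≡ B * n + C → q ≤ A * m + C
least-factor-bound-arith {A} {B} {C} {q} {m} {n} {f} B<A q≤n bernoulli eq =
  *-cancelʳ-≤ q (A * m + C) n (begin
    q * n             ≤⟨ +-cancelˡ-≤ (B * (q * n)) (q * n) (q * C + A * m * n) key ⟩
    q * C + A * m * n ≤⟨ +-monoˡ-≤ (A * m * n) (*-monoˡ-≤ C q≤n) ⟩
    n * C + A * m * n ≡⟨ solve (A ∷ C ∷ m ∷ n ∷ []) ⟩
    (A * m + C) * n   ∎)
  where
    open ≤-Reasoning
    key : B * (q * n) + q * n ≤ B * (q * n) + (q * C + A * m * n)
    key = begin
      B * (q * n) + q * n             ≡⟨ solve (B ∷ q ∷ n ∷ []) ⟩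
      suc B * (q * n)                 ≤⟨ *-monoˡ-≤ (q * n) B<A ⟩
      A * (q * n)                     ≤⟨ *-monoʳ-≤ A bernoulli ⟩
      A * (q * f + m * n)             ≡⟨ solve (A ∷ q ∷ f ∷ m ∷ n ∷ []) ⟩
      q * (A * f) + A * m * n         ≡⟨ cong (λ z → q * z + A * m * n) eq ⟩
      q * (B * n + C) + A * m * n     ≡⟨ solve (A ∷ B ∷ C ∷ q ∷ m ∷ n ∷ []) ⟩
      B * (q * n) + (q * C + A * m * n) ∎

-- Imported only now: their constructors [] and _∷_ would make the variable lists given to solve ambiguous.
open import Data.List.Relation.Unary.All using (All; []; _∷_)
import Data.List.Relation.Unary.All as All
open import Data.List.Relation.Unary.AllPairs using (AllPairs; []; _∷_)

productPred : List ℕ → ℕ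
productPred R = product (map (λ q → q ∸ 1) R)

productPred≤product : ∀ R → productPred R ≤ product R
productPred≤product []      = ≤-refl
productPred≤product (x ∷ R) = *-mono-≤ (m∸n≤m x 1) (productPred≤product R)

-- Weierstrass' product inequality ∏ (1 - 1/x) ≥ 1 - |R|/q, multiplied through by q ∏ x.
weierstrass : ∀ q R → All (q ≤_) R →
              q * product R ≤ q * productPred R + length R * product R
weierstrass q []      []         = ≤-reflexive (sym (+-identityʳ (q * 1)))
weierstrass q (x ∷ R) (q≤x ∷ q≤R) = weierstrass-step {m = length R} q≤x (weierstrass q R q≤R)

coefficient-gap : ∀ {A B C} R → 1 ≤ C →
                  A * productPred R ≡ B * product R + C → B < A
coefficient-gap {A} {B} {C} R 1≤C eq = ≰⇒> λ A≤B → <-irrefl refl (begin-strict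
  A * productPred R ≤⟨ *-mono-≤ A≤B (productPred≤product R) ⟩
  B * product R     <⟨ m<m+n (B * product R) 1≤C ⟩
  B * product R + C ≡⟨ sym eq ⟩
  A * productPred R ∎)
  where open ≤-Reasoning

least-factor-bound : ∀ {A B C} q R → 1 ≤ C → All NonZero (q ∷ R) → All (q ≤_) R →
                     A * productPred (q ∷ R) ≡ B * product (q ∷ R) + C →
                     q ≤ A * length (q ∷ R) + C
least-factor-bound {A} {B} {C} q R 1≤C nonZero@(_ ∷ nonZeroR) q≤R eq =
  least-factor-bound-arith {A} {B} {C} {q} {length (q ∷ R)} {{product≢0 nonZero}}
    (coefficient-gap {A} {B} {C} (q ∷ R) 1≤C eq)
    (m≤m*n q (product R) {{product≢0 nonZeroR}})
    (weierstrass q (q ∷ R) (≤-refl ∷ q≤R))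
    eq

entryBound : ℕ → ℕ → ℕ → ℕ
entryBound zero    A C = 0
entryBound (suc m) A C = G ⊔ entryBound m (A * G) C
  where G = A * suc m + C

sorted-solution-bounded : ∀ m {A A′ B C} R → A′ ≤ A → 1 ≤ C → length R ≡ m →
                          AllPairs _≤_ R → All NonZero R →
                          A′ * productPred R ≡ B * product R + C →
                          All (_≤ entryBound m A C) R
sorted-solution-bounded zero    []      _ _ _ _ _ _ = []
sorted-solution-bounded (suc m) {A} {A′} {B} {C} (q ∷ R) A′≤A 1≤C refl (q≤R ∷ sortedR) nonZero@(_ ∷ nonZeroR) eq =
  ≤-trans q≤G (m≤m⊔n G _) ∷ All.map (λ x≤ → ≤-trans x≤ (m≤n⊔m G _)) tail-bounded
  where
    G = A * suc m + C
    q≤G : q ≤ G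
    q≤G = ≤-trans (least-factor-bound {A′} {B} {C} q R 1≤C nonZero q≤R eq)
                  (+-monoˡ-≤ C (*-monoˡ-≤ (suc m) A′≤A))
    tail-eq : A′ * (q ∸ 1) * productPred R ≡ B * q * product R + C
    tail-eq = trans (*-assoc A′ (q ∸ 1) (productPred R))
                    (trans eq (cong (_+ C) (sym (*-assoc B q (product R)))))
    tail-bounded : All (_≤ entryBound m (A * G) C) R
    tail-bounded = sorted-solution-bounded m {A * G} {A′ * (q ∸ 1)} {B * q} {C} R
      (*-mono-≤ A′≤A (≤-trans (m∸n≤m q 1) q≤G)) 1≤C refl sortedR nonZeroR tail-eq

solution-bounded : ∀ {A B C} R → 1 ≤ C → All NonZero R →
                   A * productPred R ≡ B * product R + C →
                   All (_≤ entryBound (length R) A C) R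
solution-bounded {A} {B} {C} R 1≤C nonZero eq =
  All-resp-↭ S↭R (sorted-solution-bounded (length R) {A} {A} {B} {C} S ≤-refl 1≤C (↭-length S↭R)
    (Linked⇒AllPairs ≤-trans (sort-↗ R)) (All-resp-↭ (↭-sym S↭R) nonZero) eqS)
  where
    S = sort R
    S↭R : S ↭ R
    S↭R = sort-↭ R
    eqS : A * productPred S ≡ B * product S + C
    eqS = trans (cong (A *_) (product-↭ (map⁺ _ S↭R)))
                (trans eq (cong (λ z → B * z + C) (sym (product-↭ S↭R))))

boundedLists : ℕ → ℕ → List (List ℕ)
boundedLists zero    b = [ [] ]
boundedLists (suc k) b = cartesianProductWith _∷_ (upTo (suc b)) (boundedLists k b)

∈-boundedLists : ∀ k b R → length R ≡ k → All (_≤ b) R → R ∈ boundedLists k b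
∈-boundedLists zero    b []      _   []         = here refl
∈-boundedLists (suc k) b (x ∷ R) len (x≤b ∷ R≤b) =
  ∈-cartesianProductWith⁺ _∷_ (∈-upTo⁺ (s≤s x≤b)) (∈-boundedLists k b R (suc-injective len) R≤b)

corollary8 : (k : ℕ) → k ≥ 1 →
    ∃ λ (L : List (List ℕ)) →
      (Q : List ℕ) → ValidSet k Q → Any (λ Q′ → Q ↭ Q′) L
corollary8 k _ = boundedLists k (entryBound k 3 2) , listed
  where
    listed : (Q : List ℕ) → ValidSet k Q → Any (Q ↭_) (boundedLists k (entryBound k 3 2))
    listed Q (_ , primes , _ , _ , refl , eq) =
      Any.map ↭-reflexive (∈-boundedLists k (entryBound k 3 2) Q refl
        (solution-bounded {3} {2} {2} Q (s≤s z≤n) (All.map prime⇒nonZero primes) eq))
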